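{- The formula $\neg\neg\Diamond\Box p\to\Diamond\neg\neg\Box p$ (with $p$ a propositional variable) is not valid over the class of persistent models.
   Context: A persistent model is $(W,\preccurlyeq,S,V)$ with $\preccurlyeq$ a partial order on a nonempty set $W$, $S\colon W\to W$ both forward confluent ($w\preccurlyeq v\Rightarrow S(w)\preccurlyeq S(v)$) and backward confluent (if $v\succcurlyeq S(w)$ there is $u\succcurlyeq w$ with $S(u)=v$), and $V\colon W\to\mathcal P(\mathbb P)$ monotone. Satisfaction: $w\models p$ iff $p\in V(w)$; $\bot$ never true; $w\models\varphi\to\psi$ iff every $v\succcurlyeq w$ satisfying $\varphi$ satisfies $\psi$; $\neg\varphi:=\varphi\to\bot$; $w\models\Diamond\varphi$ iff $S^k(w)\models\varphi$ for some $k\ge0$; $w\models\Box\varphi$ iff $S^k(w)\models\varphi$ for all $k\ge0$. -}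

module Defs where

open import Data.Nat using (ℕ)
open import Data.Empty using (⊥)
open import Data.Product using (Σ; ∃; _×_)
open import Relation.Binary.PropositionalEquality using (_≡_)
open import Relation.Binary.Structures using (IsPartialOrder)
open import Function using (_∘_; id)
open import Level using (0ℓ)

data Form : Set where
  var  : ℕ → Form
  ⊥'   : Form
  _⇒_  : Form → Form → Form
  ◇    : Form → Form
  □    : Form → Form

infixr 5 _⇒_

¬' : Form → Form
¬' φ = φ ⇒ ⊥'

iter : {A : Set} → (A → A) → ℕ → A → A
iter f ℕ.zero    = id
iter f (ℕ.suc k) = f ∘ iter f k

record PersistentModel : Set₁ where
  field
    W       : Set
    inhabit : W
    _≼_     : W → W → Set
    ≼-po    : IsPartialOrder _≡_ _≼_
    S       : W → W
    fwd     : ∀ {w v} → w ≼ v → S w ≼ S v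
    bwd     : ∀ {w v} → S w ≼ v → Σ W (λ u → (w ≼ u) × (S u ≡ v))
    V       : W → ℕ → Set
    V-mono  : ∀ {w v} p → w ≼ v → V w p → V v p

module _ (M : PersistentModel) where
  open PersistentModel M

  _⊨_ : W → Form → Set
  w ⊨ var p   = V w p
  w ⊨ ⊥'      = ⊥
  w ⊨ (φ ⇒ ψ) = ∀ v → w ≼ v → v ⊨ φ → v ⊨ ψ
  w ⊨ ◇ φ     = Σ ℕ (λ k → iter S k w ⊨ φ)
  w ⊨ □ φ     = ∀ k → iter S k w ⊨ φ

ValidPersistent : Form → Set₁
ValidPersistent φ = (M : PersistentModel) → (w : PersistentModel.W M) → _⊨_ M w φ

-- A root fixed by S lies below two S-chains: leaves leaf d, which S walks down to
-- leaf 0, the only point where p holds and itself a fixed point, and points mid j,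
-- with mid j below leaf d whenever j ≤ d. Every point above the root sees some
-- leaf, and every leaf eventually satisfies □p, so ¬¬◇□p holds at the root. But
-- mid 1 sees only leaves leaf d with d ≥ 1, where p fails, so ¬□p holds at mid 1;
-- hence ¬¬□p fails at the root and, the root being fixed by S, ◇¬¬□p fails too.
module Submission where

open import Defs
open import Relation.Nullary using (¬_)
open import Data.Nat using (ℕ; zero; suc; pred; _≤_; z≤n; s≤s)
open import Data.Nat.Properties using (≤-refl; pred-mono-≤)
open import Data.Product using (Σ; _×_; _,_)
open import Relation.Binary.PropositionalEquality
  using (_≡_; refl; sym; trans; cong; subst; isEquivalence)
open import Relation.Binary.Structures using (IsPartialOrder)

iter-fixed : ∀ {A : Set} {f : A → A} {x : A} → f x ≡ x → ∀ k → iter f k x ≡ x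
iter-fixed             fx≡x zero    = refl
iter-fixed {f = f} fx≡x (suc k) = trans (cong f (iter-fixed fx≡x k)) fx≡x

iter-sucʳ : ∀ {A : Set} (f : A → A) k x → iter f (suc k) x ≡ iter f k (f x)
iter-sucʳ f zero    x = refl
iter-sucʳ f (suc k) x = cong f (iter-sucʳ f k x)

module _ (𝓜 : PersistentModel) where
  open PersistentModel 𝓜

  ⊨-¬¬-if-cofinal : ∀ {w φ} → (∀ v → w ≼ v → Σ W (λ u → v ≼ u × _⊨_ 𝓜 u φ)) →
                    _⊨_ 𝓜 w (¬' (¬' φ))
  ⊨-¬¬-if-cofinal cofinal v w≼v v⊨¬φ with cofinal v w≼v
  ... | u , v≼u , u⊨φ = v⊨¬φ u v≼u u⊨φ

  ⊭-¬¬-if-above-⊨-¬ : ∀ {w v φ} → w ≼ v → _⊨_ 𝓜 v (¬' φ) → ¬ _⊨_ 𝓜 w (¬' (¬' φ))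
  ⊭-¬¬-if-above-⊨-¬ w≼v v⊨¬φ w⊨¬¬φ = w⊨¬¬φ _ w≼v v⊨¬φ

  ⊨-◇-fixed : ∀ {w φ} → S w ≡ w → _⊨_ 𝓜 w (◇ φ) → _⊨_ 𝓜 w φ
  ⊨-◇-fixed {φ = φ} Sw≡w (k , Sᵏw⊨φ) = subst (λ u → _⊨_ 𝓜 u φ) (iter-fixed Sw≡w k) Sᵏw⊨φ

  ⊨-⇒-mp : ∀ {w φ ψ} → _⊨_ 𝓜 w (φ ⇒ ψ) → _⊨_ 𝓜 w φ → _⊨_ 𝓜 w ψ
  ⊨-⇒-mp w⊨φ⇒ψ = w⊨φ⇒ψ _ (IsPartialOrder.refl ≼-po)

data World : Set where
  root : World
  mid  : ℕ → World
  leaf : ℕ → World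

data _≼_ : World → World → Set where
  ≼-refl    : ∀ {w} → w ≼ w
  root≼mid  : ∀ {j} → root ≼ mid j
  root≼leaf : ∀ {d} → root ≼ leaf d
  mid≼leaf  : ∀ {j d} → j ≤ d → mid j ≼ leaf d

≼-trans : ∀ {u v w} → u ≼ v → v ≼ w → u ≼ w
≼-trans ≼-refl         v≼w          = v≼w
≼-trans root≼mid       ≼-refl       = root≼mid
≼-trans root≼mid       (mid≼leaf _) = root≼leaf
≼-trans root≼leaf      ≼-refl       = root≼leaf
≼-trans (mid≼leaf j≤d) ≼-refl       = mid≼leaf j≤d

≼-antisym : ∀ {v w} → v ≼ w → w ≼ v → v ≡ w
≼-antisym ≼-refl _ = refl

≼-isPartialOrder : IsPartialOrder _≡_ _≼_
≼-isPartialOrder = record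
  { isPreorder = record
    { isEquivalence = isEquivalence
    ; reflexive     = λ { refl → ≼-refl }
    ; trans         = ≼-trans
    }
  ; antisym = ≼-antisym
  }

step : World → World
step root     = root
step (mid j)  = mid (pred j)
step (leaf d) = leaf (pred d)

step-mono : ∀ {v w} → v ≼ w → step v ≼ step w
step-mono ≼-refl         = ≼-refl
step-mono root≼mid       = root≼mid
step-mono root≼leaf      = root≼leaf
step-mono (mid≼leaf j≤d) = mid≼leaf (pred-mono-≤ j≤d)

step-backward : ∀ {w v} → step w ≼ v → Σ World (λ u → w ≼ u × step u ≡ v)
step-backward {root}        ≼-refl                = root , ≼-refl , refl
step-backward {root}        (root≼mid {j})        = mid (suc j) , root≼mid , refl
step-backward {root}        (root≼leaf {d})       = leaf (suc d) , root≼leaf , refl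
step-backward {mid j}       ≼-refl                = mid j , ≼-refl , refl
step-backward {mid zero}    (mid≼leaf {d = d} _)  = leaf (suc d) , mid≼leaf z≤n , refl
step-backward {mid (suc j)} (mid≼leaf {d = d} j≤d) = leaf (suc d) , mid≼leaf (s≤s j≤d) , refl
step-backward {leaf d}      ≼-refl                = leaf d , ≼-refl , refl

valuation : World → ℕ → Set
valuation w _ = w ≡ leaf 0

valuation-mono : ∀ {v w} p → v ≼ w → valuation v p → valuation w p
valuation-mono p ≼-refl v≡leaf0 = v≡leaf0

countermodel : PersistentModel
countermodel = record
  { W = World ; inhabit = root ; _≼_ = _≼_ ; ≼-po = ≼-isPartialOrder
  ; S = step ; fwd = step-mono ; bwd = step-backward
  ; V = valuation ; V-mono = valuation-mono
  }

_⊩_ : World → Form → Set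
_⊩_ = _⊨_ countermodel

p : Form
p = var 0

leaf-reaches-leaf0 : ∀ d → iter step d (leaf d) ≡ leaf 0
leaf-reaches-leaf0 zero    = refl
leaf-reaches-leaf0 (suc d) = trans (iter-sucʳ step d (leaf (suc d))) (leaf-reaches-leaf0 d)

leaf⊩◇□p : ∀ d → leaf d ⊩ ◇ (□ p)
leaf⊩◇□p d = d , λ k → subst (λ w → iter step k w ≡ leaf 0) (sym (leaf-reaches-leaf0 d))
                               (iter-fixed {f = step} refl k)

below-leaf : ∀ w → Σ ℕ (λ d → w ≼ leaf d)
below-leaf root     = 0 , root≼leaf
below-leaf (mid j)  = j , mid≼leaf ≤-refl
below-leaf (leaf d) = d , ≼-refl

root⊩¬¬◇□p : root ⊩ ¬' (¬' (◇ (□ p)))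
root⊩¬¬◇□p = ⊨-¬¬-if-cofinal countermodel {φ = ◇ (□ p)} λ v _ →
  let d , v≼leaf = below-leaf v in leaf d , v≼leaf , leaf⊩◇□p d

mid1⊩¬□p : mid 1 ⊩ ¬' (□ p)
mid1⊩¬□p .(mid 1)  ≼-refl               w⊩□p with () ← w⊩□p 0
mid1⊩¬□p .(leaf _) (mid≼leaf (s≤s _)) w⊩□p with () ← w⊩□p 0

root⊮◇¬¬□p : ¬ (root ⊩ ◇ (¬' (¬' (□ p))))
root⊮◇¬¬□p root⊩◇¬¬□p =
  ⊭-¬¬-if-above-⊨-¬ countermodel {φ = □ p} root≼mid mid1⊩¬□p
    (⊨-◇-fixed countermodel {φ = ¬' (¬' (□ p))} refl root⊩◇¬¬□p)

lemma4p3 : ¬ ValidPersistent ((¬' (¬' (◇ (□ (var 0))))) ⇒ ◇ (¬' (¬' (□ (var 0)))))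
lemma4p3 valid = root⊮◇¬¬□p
  (⊨-⇒-mp countermodel {φ = ¬' (¬' (◇ (□ p)))} {ψ = ◇ (¬' (¬' (□ p)))}
    (valid countermodel root) root⊩¬¬◇□p)
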